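{- The self-chromatic symmetric functions $X_{K_\lambda}^{K_\lambda}$, where $\lambda$ ranges over all integer partitions, form a basis of the ring $\Lambda$ of symmetric functions.
   Context: $\Lambda$ is the ring of symmetric functions (over $\mathbb{Q}$) in infinitely many variables. $K_\lambda$ is the complete multipartite graph whose part sizes are the parts of $\lambda$. A graph homomorphism $G\to H$ is a vertex map sending edges to edges; its type is the partition of nonzero preimage sizes. For a partition $\lambda$ with $r_i(\lambda)$ parts equal to $i$, $m_\lambda^N=\frac{N!}{\binom{N}{r_1(\lambda),r_2(\lambda),\dots,N-\ell(\lambda)}}m_\lambda$ with $m_\lambda$ the monomial symmetric function. The $H$-chromatic symmetric function is $X_G^H=\sum_\lambda d_\lambda m_\lambda^{|V(H)|}$, $d_\lambda$ the number of homomorphisms $G\to H$ of type $\lambda$. -}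

module Defs where

open import Data.Bool using (Bool; true; false; _∧_; not; if_then_else_)
open import Data.Nat using (ℕ; zero; suc; _+_; _*_; _∸_; _<_; _≥_; _≤ᵇ_; _<ᵇ_; _≡ᵇ_)
open import Data.Nat using (_!)
open import Data.Nat.ListAction using (sum; product)
open import Relation.Binary.PropositionalEquality using (_≡_)
open import Data.Fin using (Fin; toℕ)
open import Data.List using (List; []; _∷_; map; filter; length; foldr; concatMap; upTo; allFin)
open import Data.List.Relation.Unary.Linked using (Linked)
open import Data.List.Relation.Unary.All using (All)
open import Data.Vec using (Vec; lookup) renaming ([] to []ᵥ; _∷_ to _∷ᵥ_)
open import Data.Product using (_×_; _,_)
open import Data.Integer using (+_)
open import Data.Rational using (ℚ; 0ℚ; _/_) renaming (_+_ to _+ℚ_; _*_ to _*ℚ_)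
open import Relation.Nullary.Decidable using (does)
import Data.List.Properties as LP
import Data.Nat.Properties as NP

record Partition : Set where
  constructor mkPartition
  field
    parts     : List ℕ
    .nonincr  : Linked _≥_ parts
    .positive : All (0 <_) parts
open Partition public

size : Partition → ℕ
size λp = sum (parts λp)

_==ᴸ_ : List ℕ → List ℕ → Bool
xs ==ᴸ ys = does (LP.≡-dec NP._≟_ xs ys)

fromℕℚ : ℕ → ℚ
fromℕℚ n = + n / 1

-- The ring Λ of symmetric functions over ℚ, presented through its
-- monomial basis: an element is a finite formal ℚ-linear combination
-- Σ q · m_μ, given as a list of pairs (q , μ).

Λ : Set
Λ = List (ℚ × Partition)

coeff : Λ → Partition → ℚ
coeff []            μ = 0ℚ
coeff ((q , ν) ∷ f) μ =
  if parts ν ==ᴸ parts μ then q +ℚ coeff f μ else coeff f μ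

_≈Λ_ : Λ → Λ → Set
f ≈Λ g = ∀ μ → coeff f μ ≡ coeff g μ

-- Vertex set Fin |λ|; vertices 0 .. λ₁-1 form the first part, the next
-- λ₂ vertices the second part, etc.  Two vertices are adjacent iff they
-- lie in different parts.

block : List ℕ → ℕ → ℕ
block []       i = 0
block (p ∷ ps) i = if i <ᵇ p then 0 else suc (block ps (i ∸ p))

adjᵇ : (λp : Partition) → Fin (size λp) → Fin (size λp) → Bool
adjᵇ λp u v = not (block (parts λp) (toℕ u) ≡ᵇ block (parts λp) (toℕ v))

_⇒ᵇ_ : Bool → Bool → Bool
a ⇒ᵇ b = not a Data.Bool.∨ b

allᵇ : {A : Set} → (A → Bool) → List A → Bool
allᵇ p = foldr (λ x r → p x ∧ r) true

isHomᵇ : (λp : Partition) → (Fin (size λp) → Fin (size λp)) → Bool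
isHomᵇ λp f =
  allᵇ (λ u → allᵇ (λ v → adjᵇ λp u v ⇒ᵇ adjᵇ λp (f u) (f v)) (allFin _)) (allFin _)

insertDesc : ℕ → List ℕ → List ℕ
insertDesc x []       = x ∷ []
insertDesc x (y ∷ ys) = if y ≤ᵇ x then x ∷ y ∷ ys else y ∷ insertDesc x ys

sortDesc : List ℕ → List ℕ
sortDesc = foldr insertDesc []

preimageSize : ∀ {n m} → (Fin n → Fin m) → Fin m → ℕ
preimageSize f w = length (filter (λ v → toℕ (f v) Data.Nat.≟ toℕ w) (allFin _))

typeOf : ∀ {n m} → (Fin n → Fin m) → List ℕ
typeOf f = sortDesc (filter (λ k → 1 Data.Nat.≤? k) (map (preimageSize f) (allFin _)))

-- all maps Fin k → Fin n, encoded as vectors of images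
allVecs : (k n : ℕ) → List (Vec (Fin n) k)
allVecs zero    n = []ᵥ ∷ []
allVecs (suc k) n = concatMap (λ w → map (w ∷ᵥ_) (allVecs k n)) (allFin n)

homCount : (λp μ : Partition) → ℕ
homCount λp μ =
  length (filter (λ v → Data.Bool._≟_
            (isHomᵇ λp (lookup v) ∧ (typeOf (lookup v) ==ᴸ parts μ)) true)
         (allVecs (size λp) (size λp)))

-- m_μ^N = N! / binom(N; r₁(μ), r₂(μ), …, N - ℓ(μ)) · m_μ
--       = r₁(μ)! r₂(μ)! ⋯ (N - ℓ(μ))! · m_μ
-- (the multinomial is N! divided by the product of these factorials;
--  r_i(μ) = 0 for i > N whenever |μ| = N, and 0! = 1).

mult : ℕ → List ℕ → ℕ
mult i xs = length (filter (λ x → x Data.Nat.≟ i) xs)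

mFactor : ℕ → Partition → ℕ
mFactor N μ =
  product (map (λ i → (mult (suc i) (parts μ)) !) (upTo N)) * ((N ∸ length (parts μ)) !)

-- Coefficient of m_μ in X^{K_λ}_{K_λ} = Σ_μ d_μ m_μ^{|V(K_λ)|},  |V(K_λ)| = |λ|.
selfChromCoeff : (λp μ : Partition) → ℚ
selfChromCoeff λp μ = fromℕℚ (homCount λp μ * mFactor (size λp) μ)

-- Finite ℚ-linear combinations Σ c_λ · X^{K_λ}_{K_λ}, again as lists of
-- pairs (c , λ); the coefficient of λ in the combination is `coeff c λ`.

LinComb : Set
LinComb = List (ℚ × Partition)

combCoeff : LinComb → Partition → ℚ
combCoeff []             μ = 0ℚ
combCoeff ((c , λp) ∷ t) μ = (c *ℚ selfChromCoeff λp μ) +ℚ combCoeff t μ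

{-# OPTIONS --safe #-}
module Submission where

-- Write μ ≺ λ when μ and λ have the same size and μ has more parts.  A homomorphism K_λ → K_λ
-- sends vertices of different parts to adjacent, hence distinct, vertices, so each of its
-- fibres lies inside one part: the fibre sizes refine λ, and the type is λ or has more parts
-- than λ.  Collapsing every part onto one of its vertices is a homomorphism of type λ.  Hence
-- the matrix of the X^{K_λ}_{K_λ} in the monomial basis is triangular for the well-founded ≺,
-- with nonzero diagonal, and induction along ≺ writes every m_μ as a combination of them.  The
-- same induction for the transposed matrix, restricted to the finitely many partitions occurring
-- in a given combination, gives a left inverse of its columns; exchanging the two finite sums
-- then shows that a vanishing combination of the X^{K_λ}_{K_λ} has vanishing coefficients.

open import Defs
open import Data.Bool using (Bool; true; false; not; _∧_; if_then_else_; T)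
open import Data.Bool.Properties using (∧-conicalˡ; ∧-conicalʳ)
open import Data.Fin using (Fin; toℕ; fromℕ<)
import Data.Fin.Properties as Fin
open import Data.List using (List; []; _∷_; [_]; _++_; map; concat; concatMap; filter; length; upTo; allFin; tabulate)
import Data.List.Properties as List
open import Data.List.Membership.Propositional using (_∈_; _∉_; find; lose)
import Data.List.Membership.Propositional.Properties as ∈
open import Data.List.Relation.Unary.All using (All; []; _∷_; all?)
import Data.List.Relation.Unary.All as All
import Data.List.Relation.Unary.All.Properties as All
open import Data.List.Relation.Unary.AllPairs using (AllPairs; []; _∷_)
import Data.List.Relation.Unary.AllPairs as AllPairs
import Data.List.Relation.Unary.AllPairs.Properties as AllPairs
open import Data.List.Relation.Unary.Any using (here; there; any?)
open import Data.List.Relation.Unary.Linked using (Linked; linked?)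
open import Data.List.Relation.Unary.Unique.Propositional using (Unique)
import Data.List.Relation.Unary.Unique.Propositional.Properties as Unique
open import Data.List.Relation.Binary.Permutation.Propositional
  using (_↭_; ↭-refl; ↭-sym; ↭-trans; ↭-reflexive; ↭⇒↭ₛ′; module PermutationReasoning)
import Data.List.Relation.Binary.Permutation.Propositional.Properties as ↭
import Data.List.Relation.Binary.Pointwise as Pointwise
import Data.List.Relation.Unary.Sorted.TotalOrder.Properties as Sorted
open import Data.Product using (Σ; ∃-syntax; _×_; _,_; proj₁; proj₂)
open import Data.Rational using (ℚ; 0ℚ; 1ℚ; Positive) renaming (_+_ to _+ℚ_; _*_ to _*ℚ_)
import Data.Rational.Properties as ℚ
open import Data.Sum using (_⊎_; inj₁; inj₂)
import Data.Sum as Sum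
open import Data.Unit using (⊤)
open import Data.Vec using (Vec; lookup) renaming ([] to []ᵥ; _∷_ to _∷ᵥ_)
import Data.Vec.Properties as Vec
open import Function using (_∘_; _on_; flip; case_of_)
open import Induction.WellFounded using (WellFounded; Acc; acc; module Subrelation)
open import Level using (Level; 0ℓ)
open import Relation.Binary.Bundles using (DecTotalOrder)
open import Relation.Binary.Core using (Rel)
open import Relation.Binary.Definitions using (DecidableEquality)
import Relation.Binary.Construct.Flip.Ord as Flip
import Relation.Binary.Construct.On as On
open import Relation.Binary.PropositionalEquality hiding ([_])
open import Relation.Nullary using (yes; no; does)
open import Relation.Nullary.Decidable using (map′; recompute; toSum; dec-true; dec-false)
open import Relation.Nullary.Negation using (contradiction)
open import Relation.Unary using (Decidable)

module FormalSum {A : Set} where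

  open Data.Rational using (_+_; _*_)
  open import Data.Rational.Solver using (module +-*-Solver)
  open +-*-Solver using (solve; _:+_; _:*_; _:=_)

  ⟦_⟧ : List (ℚ × A) → (A → ℚ) → ℚ
  ⟦ [] ⟧          g = 0ℚ
  ⟦ (q , x) ∷ c ⟧ g = q * g x + ⟦ c ⟧ g

  _·_ : ℚ → List (ℚ × A) → List (ℚ × A)
  p · c = map (λ (q , x) → (p * q , x)) c

  ⟦⟧-cong : ∀ c {g h : A → ℚ} → (∀ {x} → x ∈ map proj₂ c → g x ≡ h x) → ⟦ c ⟧ g ≡ ⟦ c ⟧ h
  ⟦⟧-cong []            g≗h = refl
  ⟦⟧-cong ((q , x) ∷ c) g≗h = cong₂ (λ a b → q * a + b) (g≗h (here refl)) (⟦⟧-cong c (g≗h ∘ there))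

  ⟦⟧-zero : ∀ c → ⟦ c ⟧ (λ _ → 0ℚ) ≡ 0ℚ
  ⟦⟧-zero []            = refl
  ⟦⟧-zero ((q , x) ∷ c) rewrite ℚ.*-zeroʳ q | ⟦⟧-zero c = refl

  ⟦⟧-+ : ∀ c (g h : A → ℚ) → ⟦ c ⟧ (λ x → g x + h x) ≡ ⟦ c ⟧ g + ⟦ c ⟧ h
  ⟦⟧-+ []            g h = refl
  ⟦⟧-+ ((q , x) ∷ c) g h rewrite ⟦⟧-+ c g h =
    solve 5 (λ q a b s t → q :* (a :+ b) :+ (s :+ t) := (q :* a :+ s) :+ (q :* b :+ t))
          refl q (g x) (h x) (⟦ c ⟧ g) (⟦ c ⟧ h)

  ⟦⟧-* : ∀ c p (g : A → ℚ) → ⟦ c ⟧ (λ x → p * g x) ≡ p * ⟦ c ⟧ g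
  ⟦⟧-* []            p g = sym (ℚ.*-zeroʳ p)
  ⟦⟧-* ((q , x) ∷ c) p g rewrite ⟦⟧-* c p g =
    solve 4 (λ q p a s → q :* (p :* a) :+ p :* s := p :* (q :* a :+ s)) refl q p (g x) (⟦ c ⟧ g)

  ⟦⟧-· : ∀ p c (g : A → ℚ) → ⟦ p · c ⟧ g ≡ p * ⟦ c ⟧ g
  ⟦⟧-· p []            g = sym (ℚ.*-zeroʳ p)
  ⟦⟧-· p ((q , x) ∷ c) g rewrite ⟦⟧-· p c g =
    solve 4 (λ p q a s → p :* q :* a :+ p :* s := p :* (q :* a :+ s)) refl p q (g x) (⟦ c ⟧ g)

  ⟦⟧-++ : ∀ c d (g : A → ℚ) → ⟦ c ++ d ⟧ g ≡ ⟦ c ⟧ g + ⟦ d ⟧ g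
  ⟦⟧-++ []            d g = sym (ℚ.+-identityˡ _)
  ⟦⟧-++ ((q , x) ∷ c) d g rewrite ⟦⟧-++ c d g = sym (ℚ.+-assoc (q * g x) _ _)

  ⟦⟧-swap : ∀ c d (F : A → A → ℚ) → ⟦ c ⟧ (λ x → ⟦ d ⟧ (F x)) ≡ ⟦ d ⟧ (λ y → ⟦ c ⟧ (λ x → F x y))
  ⟦⟧-swap []            d F = sym (⟦⟧-zero d)
  ⟦⟧-swap ((q , x) ∷ c) d F = begin
    q * ⟦ d ⟧ (F x) + ⟦ c ⟧ (λ x → ⟦ d ⟧ (F x))                ≡⟨ cong₂ _+_ (sym (⟦⟧-* d q (F x))) (⟦⟧-swap c d F) ⟩
    ⟦ d ⟧ (λ y → q * F x y) + ⟦ d ⟧ (λ y → ⟦ c ⟧ (λ x → F x y)) ≡⟨ sym (⟦⟧-+ d _ _) ⟩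
    ⟦ d ⟧ (λ y → q * F x y + ⟦ c ⟧ (λ x → F x y))              ∎
    where open ≡-Reasoning

module Triangular {A : Set} (_≟_ : DecidableEquality A) where

  open Data.Rational using (_+_; _*_; _-_; -_; 1/_; ≢-nonZero)
  open import Data.Rational.Solver using (module +-*-Solver)
  open import Algebra.Properties.Ring ℚ.+-*-ring using (-1*x≈-x)
  open FormalSum

  δ : A → A → ℚ
  δ x y = if does (x ≟ y) then 1ℚ else 0ℚ

  δ-self : ∀ x → δ x x ≡ 1ℚ
  δ-self x rewrite dec-true (x ≟ x) refl = refl

  δ-≢ : ∀ {x y} → x ≢ y → δ x y ≡ 0ℚ
  δ-≢ {x} {y} x≢y rewrite dec-false (x ≟ y) x≢y = refl

  δ-sym : ∀ x y → δ x y ≡ δ y x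
  δ-sym x y with toSum (x ≟ y)
  ... | inj₁ refl = refl
  ... | inj₂ x≢y  = trans (δ-≢ x≢y) (sym (δ-≢ (x≢y ∘ sym)))

  _without_ : (A → ℚ) → A → A → ℚ
  (g without x) y = g y - g x * δ x y

  without-self : ∀ g x → (g without x) x ≡ 0ℚ
  without-self g x rewrite δ-self x | ℚ.*-identityʳ (g x) = ℚ.+-inverseʳ (g x)

  without-≢ : ∀ g {x y} → x ≢ y → (g without x) y ≡ g y
  without-≢ g {x} x≢y rewrite δ-≢ x≢y | ℚ.*-zeroʳ (g x) = ℚ.+-identityʳ _

  without-≡0 : ∀ g {x y} → (x ≢ y → g y ≡ 0ℚ) → (g without x) y ≡ 0ℚ
  without-≡0 g {x} {y} g≡0 with toSum (x ≟ y)
  ... | inj₁ refl = without-self g x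
  ... | inj₂ x≢y  = trans (without-≢ g x≢y) (g≡0 x≢y)

  without-≢0 : ∀ g {x y} → (g without x) y ≢ 0ℚ → x ≢ y × g y ≢ 0ℚ
  without-≢0 g {x} {y} g′≢0 with toSum (x ≟ y)
  ... | inj₁ refl = contradiction (without-self g x) g′≢0
  ... | inj₂ x≢y  = x≢y , λ gy≡0 → g′≢0 (trans (without-≢ g x≢y) gy≡0)

  -- Only coordinates satisfying P are compared.  For the transposed system P is the finite set
  -- of partitions occurring in a given combination, which makes its rows finitely supported.
  module RowSpan (B : A → A → ℚ) (P : A → Set) where

    InSpan : (A → ℚ) → Set
    InSpan g = Σ (List (ℚ × A)) λ c → ∀ y → P y → ⟦ c ⟧ (λ x → B x y) ≡ g y

    InSpan-resp : ∀ {g h} → (∀ y → P y → g y ≡ h y) → InSpan g → InSpan h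
    InSpan-resp g≗h (c , c≗g) = c , λ y py → trans (c≗g y py) (g≗h y py)

    InSpan-zero : InSpan (λ _ → 0ℚ)
    InSpan-zero = [] , λ _ _ → refl

    InSpan-row : ∀ x → InSpan (B x)
    InSpan-row x = [ (1ℚ , x) ] , λ y _ → trans (ℚ.+-identityʳ _) (ℚ.*-identityˡ (B x y))

    InSpan-+ : ∀ {g h} → InSpan g → InSpan h → InSpan (λ y → g y + h y)
    InSpan-+ (c , c≗g) (d , d≗h) = c ++ d , λ y py → trans (⟦⟧-++ c d _) (cong₂ _+_ (c≗g y py) (d≗h y py))

    InSpan-* : ∀ p {g} → InSpan g → InSpan (λ y → p * g y)
    InSpan-* p (c , c≗g) = p · c , λ y py → trans (⟦⟧-· p c _) (cong (p *_) (c≗g y py))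

    InSpan-- : ∀ {g h} → InSpan g → InSpan h → InSpan (λ y → g y - h y)
    InSpan-- {g} {h} g∈ h∈ =
      InSpan-resp (λ y _ → cong (g y +_) (-1*x≈-x (h y))) (InSpan-+ g∈ (InSpan-* (- 1ℚ) h∈))

    InSpan-⟦⟧ : (∀ x → InSpan (δ x)) → ∀ c → InSpan (λ y → ⟦ c ⟧ (λ x → δ x y))
    InSpan-⟦⟧ δ∈ []            = InSpan-zero
    InSpan-⟦⟧ δ∈ ((q , x) ∷ c) = InSpan-+ (InSpan-* q (δ∈ x)) (InSpan-⟦⟧ δ∈ c)

    InSpan-finiteSupport : ∀ S g → (∀ y → P y → y ∉ S → g y ≡ 0ℚ) →
                           (∀ x → g x ≢ 0ℚ → InSpan (δ x)) → InSpan g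
    InSpan-finiteSupport []      g supp δ∈ = InSpan-resp (λ y py → sym (supp y py λ ())) InSpan-zero
    InSpan-finiteSupport (x ∷ S) g supp δ∈ =
      InSpan-resp restore (InSpan-+ (InSpan-finiteSupport S (g without x) supp′ δ∈′) component)
      where
      supp′ : ∀ y → P y → y ∉ S → (g without x) y ≡ 0ℚ
      supp′ y py y∉S = without-≡0 g λ x≢y → supp y py λ { (here y≡x) → x≢y (sym y≡x) ; (there y∈S) → y∉S y∈S }
      δ∈′ : ∀ y → (g without x) y ≢ 0ℚ → InSpan (δ y)
      δ∈′ y g′y≢0 = δ∈ y (proj₂ (without-≢0 g g′y≢0))
      component : InSpan (λ y → g x * δ x y)
      component with g x ℚ.≟ 0ℚ
      ... | yes gx≡0 = InSpan-resp (λ y _ → sym (trans (cong (_* δ x y) gx≡0) (ℚ.*-zeroˡ (δ x y)))) InSpan-zero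
      ... | no gx≢0  = InSpan-* (g x) (δ∈ x gx≢0)
      restore : ∀ y → P y → (g without x) y + g x * δ x y ≡ g y
      restore y _ = trans (ℚ.+-assoc (g y) _ _)
                          (trans (cong (g y +_) (ℚ.+-inverseˡ (g x * δ x y))) (ℚ.+-identityʳ (g y)))

    module _ {ℓ : Level} {_≺_ : Rel A ℓ} (≺-wellFounded : WellFounded _≺_)
             (diagonal : ∀ x → B x x ≢ 0ℚ)
             (triangular : ∀ x y → B x y ≢ 0ℚ → y ≡ x ⊎ y ≺ x)
             (support : A → List A)
             (support-complete : ∀ x y → P y → B x y ≢ 0ℚ → y ∈ support x) where

      δ-InSpan : ∀ x → InSpan (δ x)
      δ-InSpan x = go x (≺-wellFounded x)
        where
        -- δ x = (B x − B x without x) / B x x, and B x without x only involves δ y for y ≺ x.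
        go : ∀ x → Acc _≺_ x → InSpan (δ x)
        go x (acc below) = InSpan-resp solve-δ (InSpan-* (1/ B x x) (InSpan-- (InSpan-row x) offDiagonal))
          where
          instance _ = ≢-nonZero (diagonal x)
          offDiagonal : InSpan (B x without x)
          offDiagonal = InSpan-finiteSupport (support x) (B x without x) vanishes lower
            where
            vanishes : ∀ y → P y → y ∉ support x → (B x without x) y ≡ 0ℚ
            vanishes y py y∉ = without-≡0 (B x) λ _ → case B x y ℚ.≟ 0ℚ of λ where
              (yes Bxy≡0) → Bxy≡0
              (no Bxy≢0)  → contradiction (support-complete x y py Bxy≢0) y∉
            lower : ∀ y → (B x without x) y ≢ 0ℚ → InSpan (δ y)
            lower y B′xy≢0 with without-≢0 (B x) B′xy≢0
            ... | x≢y , Bxy≢0 with triangular x y Bxy≢0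
            ...   | inj₁ y≡x = contradiction (sym y≡x) x≢y
            ...   | inj₂ y≺x = go y (below y≺x)
          solve-δ : ∀ y → P y → 1/ B x x * (B x y - (B x without x) y) ≡ δ x y
          solve-δ y _ = begin
            1/ B x x * (B x y - (B x y - B x x * δ x y))
              ≡⟨ cong (1/ B x x *_) (solve 3 (λ b a d → a :- (a :- b :* d) := b :* d) refl (B x x) (B x y) (δ x y)) ⟩
            1/ B x x * (B x x * δ x y) ≡⟨ sym (ℚ.*-assoc (1/ B x x) (B x x) (δ x y)) ⟩
            1/ B x x * B x x * δ x y   ≡⟨ cong (_* δ x y) (ℚ.*-inverseˡ (B x x)) ⟩
            1ℚ * δ x y                 ≡⟨ ℚ.*-identityˡ _ ⟩
            δ x y                      ∎
            where
            open ≡-Reasoning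
            open +-*-Solver using (solve; _:-_; _:*_; _:=_)

open import Data.Nat
  using (ℕ; zero; suc; _+_; _*_; _∸_; _≤_; _<_; _≥_; _≟_; _≤?_; _≤ᵇ_; _<ᵇ_; _≡ᵇ_; z≤n; s≤s; NonZero; >-nonZero)
import Data.Nat.Properties as ℕ
open import Data.Nat.Induction using (<-wellFounded)
open import Data.Nat.ListAction using (sum)
open import Data.Nat.ListAction.Properties using (sum-↭; product≢0)
open import Algebra.Properties.CommutativeSemigroup ℕ.+-commutativeSemigroup
  using () renaming (interchange to +-interchange)

count : ∀ {A : Set} {P : A → Set} → Decidable P → List A → ℕ
count P? xs = length (filter P? xs)

module _ {A : Set} {P : A → Set} (P? : Decidable P) where

  count-∷ : ∀ x xs → count P? (x ∷ xs) ≡ (if does (P? x) then 1 else 0) + count P? xs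
  count-∷ x xs with does (P? x)
  ... | true  = refl
  ... | false = refl

  count-++ : ∀ xs ys → count P? (xs ++ ys) ≡ count P? xs + count P? ys
  count-++ xs ys = trans (cong length (List.filter-++ P? xs ys)) (List.length-++ (filter P? xs))

  count≢0⇒∃ : ∀ xs → count P? xs ≢ 0 → ∃[ x ] x ∈ xs × P x
  count≢0⇒∃ xs c≢0 with any? P? xs
  ... | yes some = find some
  ... | no none  = contradiction (cong length (List.filter-none P? (All.¬Any⇒All¬ xs none))) c≢0

  filter-comm : ∀ {Q : A → Set} (Q? : Decidable Q) xs → filter P? (filter Q? xs) ≡ filter Q? (filter P? xs)
  filter-comm Q? []       = refl
  filter-comm Q? (x ∷ xs) with does (P? x) in p | does (Q? x) in q
  ... | true  | true  rewrite p | q = cong (x ∷_) (filter-comm Q? xs)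
  ... | true  | false rewrite q     = filter-comm Q? xs
  ... | false | true  rewrite p     = filter-comm Q? xs
  ... | false | false               = filter-comm Q? xs

count-map : ∀ {A B : Set} {P : B → Set} (P? : Decidable P) (h : A → B) xs → count P? (map h xs) ≡ count (P? ∘ h) xs
count-map P? h []       = refl
count-map P? h (x ∷ xs) with does (P? (h x))
... | true  = cong suc (count-map P? h xs)
... | false = count-map P? h xs

sum-zeros : ∀ {xs} → All (_≡ 0) xs → sum xs ≡ 0
sum-zeros []            = refl
sum-zeros (refl ∷ xs≡0) = sum-zeros xs≡0

sum-map-+ : ∀ {A : Set} (g h : A → ℕ) xs → sum (map (λ x → g x + h x) xs) ≡ sum (map g xs) + sum (map h xs)
sum-map-+ g h []       = refl
sum-map-+ g h (x ∷ xs) rewrite sum-map-+ g h xs = +-interchange (g x) (h x) _ _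

indicator-≢ : ∀ {k i} → k ≢ i → (if does (k ≟ i) then 1 else 0) ≡ 0
indicator-≢ {k} {i} k≢i rewrite dec-false (k ≟ i) k≢i = refl

sum-indicator : ∀ {k Is} → Unique Is → k ∈ Is → sum (map (λ i → if does (k ≟ i) then 1 else 0) Is) ≡ 1
sum-indicator {k} (k∉Is ∷ _) (here refl) rewrite dec-true (k ≟ k) refl =
  cong suc (sum-zeros (All.map⁺ (All.map indicator-≢ k∉Is)))
sum-indicator {k} (i∉Is ∷ !Is) (there k∈Is) rewrite dec-false (k ≟ _) (All.lookup i∉Is k∈Is ∘ sym) =
  sum-indicator !Is k∈Is

length-fibres : ∀ {A : Set} (key : A → ℕ) {Is} → Unique Is → ∀ {D} → All (λ x → key x ∈ Is) D →
                length D ≡ sum (map (λ i → count (λ x → key x ≟ i) D) Is)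
length-fibres key {Is} !Is {[]}    []             = sym (sum-zeros (All.map⁺ (All.universal (λ _ → refl) Is)))
length-fibres key {Is} !Is {x ∷ D} (kx∈Is ∷ D∈Is) = begin
  1 + length D
    ≡⟨ cong₂ _+_ (sym (sum-indicator !Is kx∈Is)) (length-fibres key !Is D∈Is) ⟩
  sum (map (λ i → if does (key x ≟ i) then 1 else 0) Is) + sum (map (λ i → count (λ x → key x ≟ i) D) Is)
    ≡⟨ sym (sum-map-+ _ _ Is) ⟩
  sum (map (λ i → (if does (key x ≟ i) then 1 else 0) + count (λ x → key x ≟ i) D) Is)
    ≡⟨ cong sum (List.map-cong (λ i → sym (count-∷ (λ x → key x ≟ i) x D)) Is) ⟩
  sum (map (λ i → count (λ x → key x ≟ i) (x ∷ D)) Is) ∎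
  where open ≡-Reasoning

nonzeros : List ℕ → List ℕ
nonzeros = filter (1 ≤?_)

nonzeros-∷ : ∀ x xs → nonzeros (x ∷ xs) ≡ nonzeros [ x ] ++ nonzeros xs
nonzeros-∷ zero    xs = refl
nonzeros-∷ (suc x) xs = refl

nonzeros-map : ∀ {A : Set} (h : A → ℕ) xs → nonzeros (map h xs) ≡ concatMap (λ x → nonzeros [ h x ]) xs
nonzeros-map h []       = refl
nonzeros-map h (x ∷ xs) = trans (nonzeros-∷ (h x) (map h xs)) (cong (nonzeros [ h x ] ++_) (nonzeros-map h xs))

nonzeros-zeros : ∀ {xs} → All (_≡ 0) xs → nonzeros xs ≡ []
nonzeros-zeros []            = refl
nonzeros-zeros (refl ∷ xs≡0) = nonzeros-zeros xs≡0

sum-nonzeros : ∀ xs → sum (nonzeros xs) ≡ sum xs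
sum-nonzeros []           = refl
sum-nonzeros (zero ∷ xs)  = sum-nonzeros xs
sum-nonzeros (suc x ∷ xs) = cong (suc x +_) (sum-nonzeros xs)

nonzeros-sum : ∀ {xs} → AllPairs (λ x y → x ≡ 0 ⊎ y ≡ 0) xs → nonzeros xs ≡ nonzeros [ sum xs ]
nonzeros-sum {[]}         []        = refl
nonzeros-sum {zero ∷ xs}  (_ ∷ xs⊥) = nonzeros-sum xs⊥
nonzeros-sum {suc x ∷ xs} (x⊥ ∷ _)  =
  cong₂ (λ s ys → suc s ∷ ys) (sym (trans (cong (x +_) (sum-zeros xs≡0)) (ℕ.+-identityʳ x))) (nonzeros-zeros xs≡0)
  where
  xs≡0 : All (_≡ 0) xs
  xs≡0 = All.map (λ { (inj₁ ()) ; (inj₂ y≡0) → y≡0 }) x⊥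

concatMap-[] : ∀ {I B : Set} (R : List I) → concatMap {B = B} (λ _ → []) R ≡ []
concatMap-[] []      = refl
concatMap-[] (_ ∷ R) = concatMap-[] R

concatMap-++-↭ : ∀ {I B : Set} (F G : I → List B) R → concatMap (λ i → F i ++ G i) R ↭ concatMap F R ++ concatMap G R
concatMap-++-↭ F G []      = ↭-refl
concatMap-++-↭ F G (i ∷ R) = begin
  (F i ++ G i) ++ concatMap (λ i → F i ++ G i) R ↭⟨ ↭.++⁺ˡ (F i ++ G i) (concatMap-++-↭ F G R) ⟩
  (F i ++ G i) ++ (FR ++ GR)                       ↭⟨ ↭.++-assoc (F i) (G i) (FR ++ GR) ⟩
  F i ++ (G i ++ (FR ++ GR))                       ↭⟨ ↭.++⁺ˡ (F i) (↭.shifts (G i) FR) ⟩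
  F i ++ (FR ++ (G i ++ GR))                       ↭⟨ ↭-sym (↭.++-assoc (F i) FR (G i ++ GR)) ⟩
  (F i ++ FR) ++ (G i ++ GR)                       ∎
  where
  open PermutationReasoning
  FR = concatMap F R
  GR = concatMap G R

nonzeros-columnSums : ∀ {I J : Set} (g : I → J → ℕ) R W →
                      (∀ w → AllPairs (λ i j → g i w ≡ 0 ⊎ g j w ≡ 0) R) →
                      nonzeros (map (λ w → sum (map (λ i → g i w) R)) W) ↭ concatMap (λ i → nonzeros (map (g i) W)) R
nonzeros-columnSums g R []      _         = ↭-reflexive (sym (concatMap-[] R))
nonzeros-columnSums g R (w ∷ W) exclusive = begin
  nonzeros (sum column ∷ map (λ w → sum (map (λ i → g i w) R)) W)
    ≡⟨ nonzeros-∷ (sum column) _ ⟩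
  nonzeros [ sum column ] ++ rest
    ≡⟨ cong (_++ rest) (sym (nonzeros-sum (AllPairs.map⁺ (exclusive w)))) ⟩
  nonzeros column ++ rest
    ≡⟨ cong (_++ rest) (nonzeros-map (λ i → g i w) R) ⟩
  concatMap (λ i → nonzeros [ g i w ]) R ++ rest
    ↭⟨ ↭.++⁺ˡ _ (nonzeros-columnSums g R W exclusive) ⟩
  concatMap (λ i → nonzeros [ g i w ]) R ++ concatMap (λ i → nonzeros (map (g i) W)) R
    ↭⟨ ↭-sym (concatMap-++-↭ _ _ R) ⟩
  concatMap (λ i → nonzeros [ g i w ] ++ nonzeros (map (g i) W)) R
    ≡⟨ sym (List.concatMap-cong (λ i → nonzeros-∷ (g i w) _) R) ⟩
  concatMap (λ i → nonzeros (map (g i) (w ∷ W))) R ∎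
  where
  open PermutationReasoning
  column = map (λ i → g i w) R
  rest   = nonzeros (map (λ w → sum (map (λ i → g i w) R)) W)

length-nonzeros-≤1 : ∀ {A : Set} (h : A → ℕ) {W} → Unique W →
                     (∀ {w w′} → h w ≢ 0 → h w′ ≢ 0 → w ≡ w′) → length (nonzeros (map h W)) ≤ 1
length-nonzeros-≤1 h []                 _      = z≤n
length-nonzeros-≤1 h {w ∷ W} (w∉W ∷ !W) single with h w in hw
... | zero  = length-nonzeros-≤1 h !W single
... | suc _ = s≤s (ℕ.≤-reflexive (cong length (nonzeros-zeros (All.map⁺ (All.map vanishes w∉W)))))
  where
  vanishes : ∀ {w′} → w ≢ w′ → h w′ ≡ 0
  vanishes {w′} w≢w′ with h w′ ≟ 0
  ... | yes hw′≡0 = hw′≡0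
  ... | no hw′≢0  = contradiction (single (λ hw≡0 → ℕ.1+n≢0 (trans (sym hw) hw≡0)) hw′≢0) w≢w′

length≤length-concat : ∀ {xss : List (List ℕ)} → All (_≢ []) xss → length xss ≤ length (concat xss)
length≤length-concat                    []       = z≤n
length≤length-concat {[] ∷ _}           (ne ∷ _) = contradiction refl ne
length≤length-concat {(x ∷ xs) ∷ xss} (_ ∷ ne)   =
  s≤s (ℕ.≤-trans (length≤length-concat ne) (List.length-++-≤ʳ (concat xss) {xs}))

concat≡map-sum⊎longer : ∀ {xss : List (List ℕ)} → All (_≢ []) xss →
                        concat xss ≡ map sum xss ⊎ length xss < length (concat xss)
concat≡map-sum⊎longer                    []       = inj₁ refl
concat≡map-sum⊎longer {[] ∷ _}           (ne ∷ _) = contradiction refl ne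
concat≡map-sum⊎longer {(x ∷ []) ∷ xss}   (_ ∷ ne) with concat≡map-sum⊎longer ne
... | inj₁ same   = inj₁ (cong₂ _∷_ (sym (ℕ.+-identityʳ x)) same)
... | inj₂ longer = inj₂ (s≤s longer)
concat≡map-sum⊎longer {(x ∷ y ∷ ys) ∷ xss} (_ ∷ ne) =
  inj₂ (s≤s (s≤s (ℕ.≤-trans (length≤length-concat ne) (List.length-++-≤ʳ (concat xss) {ys}))))

length-concat-≤ : ∀ {A : Set} {xss : List (List A)} → All (λ xs → length xs ≤ 1) xss → length (concat xss) ≤ length xss
length-concat-≤                  []               = z≤n
length-concat-≤ {xss = xs ∷ xss} (|xs|≤1 ∷ short) =
  ℕ.≤-trans (ℕ.≤-reflexive (List.length-++ xs)) (ℕ.+-mono-≤ |xs|≤1 (length-concat-≤ short))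

upTo-suc : ∀ n → upTo (suc n) ≡ 0 ∷ map suc (upTo n)
upTo-suc n = cong (0 ∷_) (sym (List.map-upTo suc n))

upTo-+ : ∀ m n → upTo (m + n) ≡ upTo m ++ map (m +_) (upTo n)
upTo-+ zero    n = sym (List.map-id (upTo n))
upTo-+ (suc m) n = begin
  upTo (suc m + n)
    ≡⟨ upTo-suc (m + n) ⟩
  0 ∷ map suc (upTo (m + n))
    ≡⟨ cong (λ xs → 0 ∷ map suc xs) (upTo-+ m n) ⟩
  0 ∷ map suc (upTo m ++ map (m +_) (upTo n))
    ≡⟨ cong (0 ∷_) (List.map-++ suc (upTo m) _) ⟩
  0 ∷ map suc (upTo m) ++ map suc (map (m +_) (upTo n))
    ≡⟨ cong (λ xs → 0 ∷ map suc (upTo m) ++ xs) (sym (List.map-∘ (upTo n))) ⟩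
  0 ∷ map suc (upTo m) ++ map (suc m +_) (upTo n)
    ≡⟨ cong (_++ map (suc m +_) (upTo n)) (sym (upTo-suc m)) ⟩
  upTo (suc m) ++ map (suc m +_) (upTo n) ∎
  where open ≡-Reasoning

map-toℕ-allFin : ∀ n → map toℕ (allFin n) ≡ upTo n
map-toℕ-allFin n = trans (List.map-tabulate (λ i → i) toℕ) (tabulate-toℕ n)
  where
  tabulate-toℕ : ∀ n → tabulate {n = n} toℕ ≡ upTo n
  tabulate-toℕ zero    = refl
  tabulate-toℕ (suc n) = begin
    0 ∷ tabulate (toℕ ∘ Fin.suc) ≡⟨ cong (0 ∷_) (sym (List.map-tabulate toℕ suc)) ⟩
    0 ∷ map suc (tabulate toℕ)   ≡⟨ cong (λ xs → 0 ∷ map suc xs) (tabulate-toℕ n) ⟩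
    0 ∷ map suc (upTo n)         ≡⟨ sym (upTo-suc n) ⟩
    upTo (suc n)                 ∎
    where open ≡-Reasoning

block-head : ∀ {p} ps {x} → x < p → block (p ∷ ps) x ≡ 0
block-head {p} ps {x} x<p with x <ᵇ p | ℕ.<⇒<ᵇ x<p
... | true | _ = refl

block-tail : ∀ p ps y → block (p ∷ ps) (p + y) ≡ suc (block ps y)
block-tail p ps y with p + y <ᵇ p in p+y<ᵇp
... | true  = contradiction (ℕ.<ᵇ⇒< (p + y) p (subst T (sym p+y<ᵇp) _)) (ℕ.m+n≮m p y)
... | false = cong (suc ∘ block ps) (ℕ.m+n∸m≡n p y)

data Position (p : ℕ) : ℕ → Set where
  inHead : ∀ {x} → x < p → Position p x
  inTail : ∀ y → Position p (p + y)

position : ∀ p x → Position p x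
position p x with x ℕ.<? p
... | yes x<p = inHead x<p
... | no x≮p  = subst (Position p) (ℕ.m+[n∸m]≡n (ℕ.≮⇒≥ x≮p)) (inTail (x ∸ p))

block-< : ∀ ps {x} → x < sum ps → block ps x < length ps
block-< (p ∷ ps) {x} x<Σ with position p x
... | inHead x<p = subst (_< length (p ∷ ps)) (sym (block-head ps x<p)) (s≤s z≤n)
... | inTail y   = subst (_< length (p ∷ ps)) (sym (block-tail p ps y)) (s≤s (block-< ps (ℕ.+-cancelˡ-< p y _ x<Σ)))

blockSize : List ℕ → ℕ → ℕ
blockSize ps i = count (λ x → block ps x ≟ i) (upTo (sum ps))

blockSize-∷ : ∀ p ps i → blockSize (p ∷ ps) i ≡
              count (λ x → block (p ∷ ps) x ≟ i) (upTo p) + count (λ y → block (p ∷ ps) (p + y) ≟ i) (upTo (sum ps))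
blockSize-∷ p ps i = begin
  count B? (upTo (p + sum ps))
    ≡⟨ cong (count B?) (upTo-+ p (sum ps)) ⟩
  count B? (upTo p ++ map (p +_) (upTo (sum ps)))
    ≡⟨ count-++ B? (upTo p) _ ⟩
  count B? (upTo p) + count B? (map (p +_) (upTo (sum ps)))
    ≡⟨ cong (count B? (upTo p) +_) (count-map B? (p +_) (upTo (sum ps))) ⟩
  count B? (upTo p) + count (B? ∘ (p +_)) (upTo (sum ps)) ∎
  where
  open ≡-Reasoning
  B? = λ x → block (p ∷ ps) x ≟ i

blockSize-head : ∀ p ps → blockSize (p ∷ ps) 0 ≡ p
blockSize-head p ps rewrite blockSize-∷ p ps 0
  | List.filter-all (λ x → block (p ∷ ps) x ≟ 0) (All.map (block-head ps) (All.all-upTo p))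
  | List.filter-none (λ y → block (p ∷ ps) (p + y) ≟ 0)
                     (All.universal (λ y → ℕ.1+n≢0 ∘ trans (sym (block-tail p ps y))) (upTo (sum ps)))
  = trans (ℕ.+-identityʳ _) (List.length-upTo p)

blockSize-tail : ∀ p ps i → blockSize (p ∷ ps) (suc i) ≡ blockSize ps i
blockSize-tail p ps i rewrite blockSize-∷ p ps (suc i)
  | List.filter-none (λ x → block (p ∷ ps) x ≟ suc i)
                     (All.map (λ x<p → ℕ.0≢1+n ∘ trans (sym (block-head ps x<p))) (All.all-upTo p))
  = cong length (List.filter-≐ _ _ (tail⇒ , ⇒tail) (upTo (sum ps)))
  where
  tail⇒ : ∀ {y} → block (p ∷ ps) (p + y) ≡ suc i → block ps y ≡ i
  tail⇒ = ℕ.suc-injective ∘ trans (sym (block-tail p ps _))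
  ⇒tail : ∀ {y} → block ps y ≡ i → block (p ∷ ps) (p + y) ≡ suc i
  ⇒tail = trans (block-tail p ps _) ∘ cong suc

map-blockSize : ∀ ps → map (blockSize ps) (upTo (length ps)) ≡ ps
map-blockSize []       = refl
map-blockSize (p ∷ ps) = begin
  map (blockSize (p ∷ ps)) (upTo (suc (length ps)))
    ≡⟨ cong (map (blockSize (p ∷ ps))) (upTo-suc (length ps)) ⟩
  blockSize (p ∷ ps) 0 ∷ map (blockSize (p ∷ ps)) (map suc (upTo (length ps)))
    ≡⟨ cong₂ _∷_ (blockSize-head p ps) (sym (List.map-∘ (upTo (length ps)))) ⟩
  p ∷ map (blockSize (p ∷ ps) ∘ suc) (upTo (length ps))
    ≡⟨ cong (p ∷_) (trans (List.map-cong (blockSize-tail p ps) _) (map-blockSize ps)) ⟩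
  p ∷ ps ∎
  where open ≡-Reasoning

blockStart : List ℕ → ℕ → ℕ
blockStart []       _       = 0
blockStart (p ∷ ps) zero    = 0
blockStart (p ∷ ps) (suc i) = p + blockStart ps i

blockStart-≤ : ∀ ps x → blockStart ps (block ps x) ≤ x
blockStart-≤ []       x = z≤n
blockStart-≤ (p ∷ ps) x with position p x
... | inHead x<p rewrite block-head ps x<p = z≤n
... | inTail y   rewrite block-tail p ps y = ℕ.+-monoʳ-≤ p (blockStart-≤ ps y)

block-blockStart : ∀ ps x → block ps (blockStart ps (block ps x)) ≡ block ps x
block-blockStart []       x = refl
block-blockStart (p ∷ ps) x with position p x
... | inHead x<p rewrite block-head ps x<p = block-head ps (ℕ.≤-<-trans z≤n x<p)
... | inTail y   rewrite block-tail p ps y = trans (block-tail p ps _) (cong suc (block-blockStart ps y))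

≥-decTotalOrder : DecTotalOrder 0ℓ 0ℓ 0ℓ
≥-decTotalOrder = Flip.decTotalOrder ℕ.≤-decTotalOrder

open import Data.List.Sort.InsertionSort.Base ≥-decTotalOrder using (insert; sort)
open import Data.List.Sort.InsertionSort.Properties ≥-decTotalOrder using (sort-↭; sort-↗)

insertDesc≡insert : ∀ x ys → insertDesc x ys ≡ insert x ys
insertDesc≡insert x []       = refl
insertDesc≡insert x (y ∷ ys) with y ≤ᵇ x
... | true  = refl
... | false = cong (y ∷_) (insertDesc≡insert x ys)

sortDesc≡sort : ∀ xs → sortDesc xs ≡ sort xs
sortDesc≡sort []       = refl
sortDesc≡sort (x ∷ xs) rewrite sortDesc≡sort xs = insertDesc≡insert x (sort xs)

sortDesc-↭ : ∀ xs → sortDesc xs ↭ xs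
sortDesc-↭ xs rewrite sortDesc≡sort xs = sort-↭ xs

sortDesc-sorted : ∀ xs → Linked _≥_ (sortDesc xs)
sortDesc-sorted xs rewrite sortDesc≡sort xs = sort-↗ xs

sorted-↭⇒≡ : ∀ {xs ys} → Linked _≥_ xs → Linked _≥_ ys → xs ↭ ys → xs ≡ ys
sorted-↭⇒≡ xs↘ ys↘ xs↭ys = Pointwise.Pointwise-≡⇒≡ (Pointwise.map sym
  (Sorted.↗↭↗⇒≋ (DecTotalOrder.totalOrder ≥-decTotalOrder) xs↘ ys↘
                (↭⇒↭ₛ′ (DecTotalOrder.isEquivalence ≥-decTotalOrder) xs↭ys)))

parts-injective : ∀ {μ ν} → parts μ ≡ parts ν → μ ≡ ν
parts-injective {mkPartition _ _ _} {mkPartition _ _ _} refl = refl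

-- `does (μ ≟ₚ ν)` is definitionally `parts μ ==ᴸ parts ν`, the test performed by coeff.
_≟ₚ_ : DecidableEquality Partition
μ ≟ₚ ν = map′ parts-injective (cong parts) (List.≡-dec _≟_ (parts μ) (parts ν))

parts-positive : ∀ μ → All (0 <_) (parts μ)
parts-positive (mkPartition xs _ positive) = recompute (all? (0 ℕ.<?_) xs) positive

parts-sorted : ∀ μ → Linked _≥_ (parts μ)
parts-sorted (mkPartition xs sorted _) = recompute (linked? (flip _≤?_) xs) sorted

length≤size : ∀ μ → length (parts μ) ≤ size μ
length≤size μ = go (parts-positive μ)
  where
  go : ∀ {xs} → All (0 <_) xs → length xs ≤ sum xs
  go []         = z≤n
  go (x>0 ∷ xs) = ℕ.+-mono-≤ x>0 (go xs)

_≺_ : Rel Partition 0ℓ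
μ ≺ ν = size μ ≡ size ν × length (parts ν) < length (parts μ)

≺-wellFounded : WellFounded _≺_
≺-wellFounded = Subrelation.wellFounded (λ {μ} {ν} → ≺⇒< {μ} {ν}) (On.wellFounded excess <-wellFounded)
  where
  excess : Partition → ℕ
  excess μ = size μ ∸ length (parts μ)
  ≺⇒< : ∀ {μ ν} → μ ≺ ν → excess μ < excess ν
  ≺⇒< {μ} (|μ|≡|ν| , ℓν<ℓμ) rewrite sym |μ|≡|ν| = ℕ.∸-monoʳ-< ℓν<ℓμ (length≤size μ)

≻-wellFounded : WellFounded (flip _≺_)
≻-wellFounded =
  Subrelation.wellFounded {_<₂_ = _<_ on (length ∘ parts)} proj₂ (On.wellFounded (length ∘ parts) <-wellFounded)

module _ {n m} (f : Fin n → Fin m) where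

  sum-fibreSizes : ∀ D → sum (map (λ w → count (λ v → toℕ (f v) ≟ toℕ w) D) (allFin m)) ≡ length D
  sum-fibreSizes D = sym (begin
    length D
      ≡⟨ length-fibres (toℕ ∘ f) (Unique.map⁺ Fin.toℕ-injective (Unique.allFin⁺ m))
                       (All.universal (λ v → ∈.∈-map⁺ toℕ (∈.∈-allFin (f v))) D) ⟩
    sum (map (λ k → count (λ v → toℕ (f v) ≟ k) D) (map toℕ (allFin m)))
      ≡⟨ cong sum (sym (List.map-∘ (allFin m))) ⟩
    sum (map (λ w → count (λ v → toℕ (f v) ≟ toℕ w) D) (allFin m)) ∎)
    where open ≡-Reasoning

  private
    fibreSizes = nonzeros (map (preimageSize f) (allFin m))

  sum-typeOf : sum (typeOf f) ≡ n
  sum-typeOf = begin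
    sum (sortDesc fibreSizes)             ≡⟨ sum-↭ (sortDesc-↭ fibreSizes) ⟩
    sum fibreSizes                        ≡⟨ sum-nonzeros (map (preimageSize f) (allFin m)) ⟩
    sum (map (preimageSize f) (allFin m)) ≡⟨ sum-fibreSizes (allFin n) ⟩
    length (allFin n)                     ≡⟨ List.length-tabulate (λ i → i) ⟩
    n                                     ∎
    where open ≡-Reasoning

  typePartition : Partition
  typePartition = mkPartition (typeOf f) (sortDesc-sorted fibreSizes)
    (↭.All-resp-↭ (↭-sym (sortDesc-↭ fibreSizes)) (All.all-filter (1 ≤?_) (map (preimageSize f) (allFin m))))

allᵇ-true⁻ : ∀ {A : Set} (p : A → Bool) {xs} → allᵇ p xs ≡ true → ∀ {x} → x ∈ xs → p x ≡ true
allᵇ-true⁻ p {y ∷ _} all≡t (here refl)  = ∧-conicalˡ (p y) _ all≡t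
allᵇ-true⁻ p {y ∷ _} all≡t (there x∈xs) = allᵇ-true⁻ p (∧-conicalʳ (p y) _ all≡t) x∈xs

allᵇ-true⁺ : ∀ {A : Set} (p : A → Bool) xs → (∀ x → p x ≡ true) → allᵇ p xs ≡ true
allᵇ-true⁺ p []       _   = refl
allᵇ-true⁺ p (x ∷ xs) p≡t rewrite p≡t x = allᵇ-true⁺ p xs p≡t

module CompleteMultipartite (λp : Partition) where

  private
    n = size λp
    ℓ = length (parts λp)
    V = allFin n

  blockOf : Fin n → ℕ
  blockOf v = block (parts λp) (toℕ v)

  adjᵇ≡true : ∀ {u v} → blockOf u ≢ blockOf v → adjᵇ λp u v ≡ true
  adjᵇ≡true {u} {v} u≁v with blockOf u ≡ᵇ blockOf v in eq
  ... | true  = contradiction (ℕ.≡ᵇ⇒≡ _ _ (subst T (sym eq) _)) u≁v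
  ... | false = refl

  adjᵇ≡true⁻ : ∀ {u v} → adjᵇ λp u v ≡ true → blockOf u ≢ blockOf v
  adjᵇ≡true⁻ {u} {v} u~v u≈v with blockOf u ≡ᵇ blockOf v | ℕ.≡⇒≡ᵇ _ _ u≈v
  ... | true | _ = contradiction u~v λ ()

  hom-separates : ∀ {f} → isHomᵇ λp f ≡ true → ∀ {u v} → blockOf u ≢ blockOf v → f u ≢ f v
  hom-separates {f} hom {u} {v} u≁v fu≡fv = adjᵇ≡true⁻ fu~fv (cong blockOf fu≡fv)
    where
    fu~fv : adjᵇ λp (f u) (f v) ≡ true
    fu~fv = subst (λ a → (a ⇒ᵇ adjᵇ λp (f u) (f v)) ≡ true) (adjᵇ≡true u≁v)
                  (allᵇ-true⁻ _ (allᵇ-true⁻ _ hom (∈.∈-allFin u)) (∈.∈-allFin v))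

  blockPreserving-isHom : ∀ f → (∀ v → blockOf (f v) ≡ blockOf v) → isHomᵇ λp f ≡ true
  blockPreserving-isHom f preserves = allᵇ-true⁺ _ V λ u → allᵇ-true⁺ _ V λ v →
    subst (λ a → (adjᵇ λp u v ⇒ᵇ a) ≡ true)
          (cong₂ (λ a b → not (a ≡ᵇ b)) (sym (preserves u)) (sym (preserves v))) (⇒ᵇ-refl (adjᵇ λp u v))
    where
    ⇒ᵇ-refl : ∀ a → (a ⇒ᵇ a) ≡ true
    ⇒ᵇ-refl true  = refl
    ⇒ᵇ-refl false = refl

  module _ (f : Fin n → Fin n) where

    fibre : Fin n → List (Fin n)
    fibre w = filter (λ v → toℕ (f v) ≟ toℕ w) V

    fibreInPart : ℕ → Fin n → ℕ
    fibreInPart i w = count (λ v → blockOf v ≟ i) (fibre w)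

    -- the types of the restrictions of f to the parts of λ
    partTypes : List (List ℕ)
    partTypes = map (λ i → nonzeros (map (fibreInPart i) V)) (upTo ℓ)

    preimageSize≡sum-column : ∀ w → preimageSize f w ≡ sum (map (λ i → fibreInPart i w) (upTo ℓ))
    preimageSize≡sum-column w =
      length-fibres blockOf (Unique.upTo⁺ ℓ)
                    (All.universal (λ v → ∈.∈-upTo⁺ (block-< (parts λp) (Fin.toℕ<n v))) (fibre w))

    sum-row : ∀ i → sum (map (fibreInPart i) V) ≡ blockSize (parts λp) i
    sum-row i = begin
      sum (map (fibreInPart i) V)
        ≡⟨ cong sum (List.map-cong (λ w → cong length (filter-comm (λ v → blockOf v ≟ i) _ V)) V) ⟩
      sum (map (λ w → count (λ v → toℕ (f v) ≟ toℕ w) (filter (λ v → blockOf v ≟ i) V)) V)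
        ≡⟨ sum-fibreSizes f (filter (λ v → blockOf v ≟ i) V) ⟩
      count (λ v → blockOf v ≟ i) V
        ≡⟨ sym (count-map (λ x → block (parts λp) x ≟ i) toℕ V) ⟩
      count (λ x → block (parts λp) x ≟ i) (map toℕ V)
        ≡⟨ cong (count (λ x → block (parts λp) x ≟ i)) (map-toℕ-allFin n) ⟩
      blockSize (parts λp) i ∎
      where open ≡-Reasoning

    fibreInPart≢0 : ∀ {i w} → fibreInPart i w ≢ 0 → ∃[ v ] blockOf v ≡ i × f v ≡ w
    fibreInPart≢0 {i} {w} ≢0 with count≢0⇒∃ (λ v → blockOf v ≟ i) (fibre w) ≢0
    ... | v , v∈fibre , v∈i =
      v , v∈i , Fin.toℕ-injective (proj₂ (∈.∈-filter⁻ (λ v → toℕ (f v) ≟ toℕ w) {xs = V} v∈fibre))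

    hom-exclusive : isHomᵇ λp f ≡ true → ∀ w → AllPairs (λ i j → fibreInPart i w ≡ 0 ⊎ fibreInPart j w ≡ 0) (upTo ℓ)
    hom-exclusive hom w = AllPairs.map exclusive (Unique.upTo⁺ ℓ)
      where
      exclusive : ∀ {i j} → i ≢ j → fibreInPart i w ≡ 0 ⊎ fibreInPart j w ≡ 0
      exclusive {i} {j} i≢j with fibreInPart i w ≟ 0 | fibreInPart j w ≟ 0
      ... | yes ≡0 | _      = inj₁ ≡0
      ... | no _   | yes ≡0 = inj₂ ≡0
      ... | no ≢0  | no ≢0′ with fibreInPart≢0 ≢0 | fibreInPart≢0 ≢0′
      ...   | u , u∈i , fu≡w | v , v∈j , fv≡w =
              contradiction (trans fu≡w (sym fv≡w)) (hom-separates hom λ u≈v → i≢j (trans (sym u∈i) (trans u≈v v∈j)))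

    partTypes-nonEmpty : All (_≢ []) partTypes
    partTypes-nonEmpty =
      All.map⁺ (All.map nonEmpty (All.map⁻ (subst (All (0 <_)) (sym (map-blockSize (parts λp))) (parts-positive λp))))
      where
      nonEmpty : ∀ {i} → 0 < blockSize (parts λp) i → nonzeros (map (fibreInPart i) V) ≢ []
      nonEmpty {i} size>0 ≡[] =
        ℕ.<⇒≢ size>0 (sym (trans (sym (sum-row i)) (trans (sym (sum-nonzeros (map (fibreInPart i) V))) (cong sum ≡[]))))

    map-sum-partTypes : map sum partTypes ≡ parts λp
    map-sum-partTypes = begin
      map sum partTypes
        ≡⟨ sym (List.map-∘ (upTo ℓ)) ⟩
      map (λ i → sum (nonzeros (map (fibreInPart i) V))) (upTo ℓ)
        ≡⟨ List.map-cong (λ i → trans (sum-nonzeros (map (fibreInPart i) V)) (sum-row i)) (upTo ℓ) ⟩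
      map (blockSize (parts λp)) (upTo ℓ)
        ≡⟨ map-blockSize (parts λp) ⟩
      parts λp ∎
      where open ≡-Reasoning

    length-partTypes : length partTypes ≡ ℓ
    length-partTypes = trans (List.length-map _ (upTo ℓ)) (List.length-upTo ℓ)

    typeOf↭partTypes : isHomᵇ λp f ≡ true → typeOf f ↭ concat partTypes
    typeOf↭partTypes hom = ↭-trans (sortDesc-↭ (nonzeros (map (preimageSize f) V))) (↭-trans
      (↭-reflexive (cong nonzeros (List.map-cong preimageSize≡sum-column V)))
      (nonzeros-columnSums fibreInPart (upTo ℓ) V (hom-exclusive hom)))

    typeOf-hom : isHomᵇ λp f ≡ true → typeOf f ≡ parts λp ⊎ ℓ < length (typeOf f)
    typeOf-hom hom with concat≡map-sum⊎longer partTypes-nonEmpty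
    ... | inj₁ same   = inj₁ (sorted-↭⇒≡ (sortDesc-sorted (nonzeros (map (preimageSize f) V))) (parts-sorted λp)
                                         (↭-trans (typeOf↭partTypes hom) (↭-reflexive (trans same map-sum-partTypes))))
    ... | inj₂ longer = inj₂ (subst₂ _<_ length-partTypes (sym (↭.↭-length (typeOf↭partTypes hom))) longer)

    typeOf-blockConstant : isHomᵇ λp f ≡ true → (∀ {u v} → blockOf u ≡ blockOf v → f u ≡ f v) → typeOf f ≡ parts λp
    typeOf-blockConstant hom constant with typeOf-hom hom
    ... | inj₁ same   = same
    ... | inj₂ longer = contradiction longer (ℕ.≤⇒≯ short)
      where
      singleTarget : ∀ i {w w′} → fibreInPart i w ≢ 0 → fibreInPart i w′ ≢ 0 → w ≡ w′
      singleTarget i ≢0 ≢0′ with fibreInPart≢0 ≢0 | fibreInPart≢0 ≢0′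
      ... | u , u∈i , fu≡w | v , v∈i , fv≡w′ = trans (sym fu≡w) (trans (constant (trans u∈i (sym v∈i))) fv≡w′)
      rowShort : ∀ i → length (nonzeros (map (fibreInPart i) V)) ≤ 1
      rowShort i = length-nonzeros-≤1 (fibreInPart i) (Unique.allFin⁺ n) (singleTarget i)
      short : length (typeOf f) ≤ ℓ
      short = begin
        length (typeOf f)         ≡⟨ ↭.↭-length (typeOf↭partTypes hom) ⟩
        length (concat partTypes) ≤⟨ length-concat-≤ (All.map⁺ (All.universal rowShort (upTo ℓ))) ⟩
        length partTypes          ≡⟨ length-partTypes ⟩
        ℓ                         ∎
        where open ℕ.≤-Reasoning

  collapse : Fin n → Fin n
  collapse v = fromℕ< (ℕ.≤-<-trans (blockStart-≤ (parts λp) (toℕ v)) (Fin.toℕ<n v))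

  toℕ-collapse : ∀ v → toℕ (collapse v) ≡ blockStart (parts λp) (blockOf v)
  toℕ-collapse v = Fin.toℕ-fromℕ< _

  module _ {f : Fin n → Fin n} (f≗collapse : ∀ v → f v ≡ collapse v) where

    collapse-isHom : isHomᵇ λp f ≡ true
    collapse-isHom = blockPreserving-isHom f λ v → begin
      blockOf (f v)                                           ≡⟨ cong blockOf (f≗collapse v) ⟩
      block (parts λp) (toℕ (collapse v))                     ≡⟨ cong (block (parts λp)) (toℕ-collapse v) ⟩
      block (parts λp) (blockStart (parts λp) (blockOf v))    ≡⟨ block-blockStart (parts λp) (toℕ v) ⟩
      blockOf v                                               ∎
      where open ≡-Reasoning

    typeOf-collapse : typeOf f ≡ parts λp
    typeOf-collapse = typeOf-blockConstant f collapse-isHom λ {u} {v} u≈v → begin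
      f u        ≡⟨ f≗collapse u ⟩
      collapse u ≡⟨ Fin.toℕ-injective (trans (toℕ-collapse u) (trans (cong (blockStart (parts λp)) u≈v)
                                                                       (sym (toℕ-collapse v)))) ⟩
      collapse v ≡⟨ sym (f≗collapse v) ⟩
      f v        ∎
      where open ≡-Reasoning

∈-allVecs : ∀ k n (v : Vec (Fin n) k) → v ∈ allVecs k n
∈-allVecs zero    n []ᵥ       = here refl
∈-allVecs (suc k) n (w ∷ᵥ v) =
  ∈.∈-concatMap⁺ (λ w → map (w ∷ᵥ_) (allVecs k n)) (lose (∈.∈-allFin w) (∈.∈-map⁺ (w ∷ᵥ_) (∈-allVecs k n v)))

==ᴸ-sound : ∀ {xs ys} → (xs ==ᴸ ys) ≡ true → xs ≡ ys
==ᴸ-sound {xs} {ys} eq with List.≡-dec _≟_ xs ys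
... | yes xs≡ys = xs≡ys

homCount≢0⇒hom : ∀ λp μ → homCount λp μ ≢ 0 →
                 ∃[ v ] v ∈ allVecs (size λp) (size λp) × isHomᵇ λp (lookup v) ≡ true × typeOf (lookup v) ≡ parts μ
homCount≢0⇒hom λp μ ≢0
  with count≢0⇒∃ (λ v → isHomᵇ λp (lookup v) ∧ (typeOf (lookup v) ==ᴸ parts μ) Data.Bool.≟ true) _ ≢0
... | v , v∈ , hom∧type = v , v∈ , ∧-conicalˡ _ _ hom∧type , ==ᴸ-sound (∧-conicalʳ _ _ hom∧type)

homCount-diagonal : ∀ λp → NonZero (homCount λp λp)
homCount-diagonal λp = >-nonZero (List.filter-some _ (lose (∈-allVecs n n v) hom∧type))
  where
  open CompleteMultipartite λp
  n = size λp
  v = Data.Vec.tabulate collapse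
  lookup≗collapse : ∀ u → lookup v u ≡ collapse u
  lookup≗collapse = Vec.lookup∘tabulate collapse
  hom∧type : (isHomᵇ λp (lookup v) ∧ (typeOf (lookup v) ==ᴸ parts λp)) ≡ true
  hom∧type rewrite collapse-isHom lookup≗collapse | typeOf-collapse lookup≗collapse =
    dec-true (List.≡-dec _≟_ (parts λp) (parts λp)) refl

fromℕℚ≢0 : ∀ k .{{_ : NonZero k}} → fromℕℚ k ≢ 0ℚ
fromℕℚ≢0 (suc k) k≡0 with subst Positive k≡0 (ℚ.normalize-pos (suc k) 1)
... | ()

mFactor-nonZero : ∀ N μ → NonZero (mFactor N μ)
mFactor-nonZero N μ = ℕ.m*n≢0 _ _
  {{product≢0 (All.map⁺ (All.universal (λ i → mult (suc i) (parts μ) ℕ.!≢0) (upTo N)))}}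
  {{(N ∸ length (parts μ)) ℕ.!≢0}}

selfChromCoeff≢0⇒homCount≢0 : ∀ λp μ → selfChromCoeff λp μ ≢ 0ℚ → homCount λp μ ≢ 0
selfChromCoeff≢0⇒homCount≢0 λp μ ≢0 ≡0 = ≢0 (cong (λ k → fromℕℚ (k * mFactor (size λp) μ)) ≡0)

selfChromCoeff-diagonal : ∀ λp → selfChromCoeff λp λp ≢ 0ℚ
selfChromCoeff-diagonal λp = fromℕℚ≢0 (homCount λp λp * mFactor (size λp) λp)
  {{ℕ.m*n≢0 _ _ {{homCount-diagonal λp}} {{mFactor-nonZero (size λp) λp}}}}

hom-triangular : ∀ λp μ {f} → isHomᵇ λp f ≡ true → typeOf f ≡ parts μ → μ ≡ λp ⊎ μ ≺ λp
hom-triangular λp μ {f} hom type≡μ with CompleteMultipartite.typeOf-hom λp f hom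
... | inj₁ type≡λ = inj₁ (parts-injective (trans (sym type≡μ) type≡λ))
... | inj₂ longer = inj₂ (trans (cong sum (sym type≡μ)) (sum-typeOf f) , subst (λ xs → _ < length xs) type≡μ longer)

selfChromCoeff-triangular : ∀ λp μ → selfChromCoeff λp μ ≢ 0ℚ → μ ≡ λp ⊎ μ ≺ λp
selfChromCoeff-triangular λp μ ≢0 =
  let v , _ , hom , type≡μ = homCount≢0⇒hom λp μ (selfChromCoeff≢0⇒homCount≢0 λp μ ≢0)
  in  hom-triangular λp μ hom type≡μ

typesOfMaps : Partition → List Partition
typesOfMaps λp = map (typePartition ∘ lookup) (allVecs (size λp) (size λp))

selfChromCoeff-support : ∀ λp μ → selfChromCoeff λp μ ≢ 0ℚ → μ ∈ typesOfMaps λp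
selfChromCoeff-support λp μ ≢0 =
  let v , v∈ , _ , type≡μ = homCount≢0⇒hom λp μ (selfChromCoeff≢0⇒homCount≢0 λp μ ≢0)
  in  subst (_∈ typesOfMaps λp) (parts-injective type≡μ) (∈.∈-map⁺ (typePartition ∘ lookup) v∈)

open FormalSum
open Triangular _≟ₚ_

coeff≡⟦⟧ : ∀ f μ → coeff f μ ≡ ⟦ f ⟧ (λ ν → δ ν μ)
coeff≡⟦⟧ []            μ = refl
coeff≡⟦⟧ ((q , ν) ∷ f) μ with does (ν ≟ₚ μ)
... | true  = cong₂ _+ℚ_ (sym (ℚ.*-identityʳ q)) (coeff≡⟦⟧ f μ)
... | false = trans (coeff≡⟦⟧ f μ) (sym (trans (cong (_+ℚ ⟦ f ⟧ (λ ν → δ ν μ)) (ℚ.*-zeroʳ q)) (ℚ.+-identityˡ _)))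

combCoeff≡⟦⟧ : ∀ c μ → combCoeff c μ ≡ ⟦ c ⟧ (λ ν → selfChromCoeff ν μ)
combCoeff≡⟦⟧ []            μ = refl
combCoeff≡⟦⟧ ((q , ν) ∷ c) μ = cong (q *ℚ selfChromCoeff ν μ +ℚ_) (combCoeff≡⟦⟧ c μ)

selfChrom-spanning : (f : Λ) → Σ LinComb (λ c → ∀ μ → combCoeff c μ ≡ coeff f μ)
selfChrom-spanning f = c , λ μ → trans (combCoeff≡⟦⟧ c μ) (trans (c≗f μ _) (sym (coeff≡⟦⟧ f μ)))
  where
  open RowSpan selfChromCoeff (λ _ → ⊤)
  rows⁻¹ : ∀ μ → InSpan (δ μ)
  rows⁻¹ = δ-InSpan ≺-wellFounded selfChromCoeff-diagonal selfChromCoeff-triangular typesOfMaps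
                    (λ λp μ _ → selfChromCoeff-support λp μ)
  c   = proj₁ (InSpan-⟦⟧ rows⁻¹ f)
  c≗f = proj₂ (InSpan-⟦⟧ rows⁻¹ f)

selfChrom-independent : (c : LinComb) → (∀ μ → combCoeff c μ ≡ 0ℚ) → ∀ λp → coeff c λp ≡ 0ℚ
selfChrom-independent c c≡0 λp = begin
  coeff c λp                                     ≡⟨ coeff≡⟦⟧ c λp ⟩
  ⟦ c ⟧ (λ ν → δ ν λp)                           ≡⟨ ⟦⟧-cong c (λ {ν} ν∈c → trans (δ-sym ν λp) (sym (w≗δ ν ν∈c))) ⟩
  ⟦ c ⟧ (λ ν → ⟦ w ⟧ (selfChromCoeff ν))         ≡⟨ ⟦⟧-swap c w selfChromCoeff ⟩
  ⟦ w ⟧ (λ κ → ⟦ c ⟧ (λ ν → selfChromCoeff ν κ)) ≡⟨ ⟦⟧-cong w (λ {κ} _ → trans (sym (combCoeff≡⟦⟧ c κ)) (c≡0 κ)) ⟩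
  ⟦ w ⟧ (λ _ → 0ℚ)                               ≡⟨ ⟦⟧-zero w ⟩
  0ℚ                                             ∎
  where
  open ≡-Reasoning
  open RowSpan (flip selfChromCoeff) (_∈ map proj₂ c)
  transposed-triangular : ∀ λp μ → selfChromCoeff μ λp ≢ 0ℚ → μ ≡ λp ⊎ flip _≺_ μ λp
  transposed-triangular λp μ ≢0 = Sum.map₁ sym (selfChromCoeff-triangular μ λp ≢0)
  column⁻¹ : InSpan (δ λp)
  column⁻¹ = δ-InSpan ≻-wellFounded selfChromCoeff-diagonal transposed-triangular
                      (λ _ → map proj₂ c) (λ _ _ μ∈c _ → μ∈c) λp
  w   = proj₁ column⁻¹
  w≗δ = proj₂ column⁻¹

proposition4p1 :
    ((f : Λ) → Σ LinComb (λ c → ∀ μ → combCoeff c μ ≡ coeff f μ))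
    × ((c : LinComb) → (∀ μ → combCoeff c μ ≡ 0ℚ) → ∀ λp → coeff c λp ≡ 0ℚ)
proposition4p1 = selfChrom-spanning , selfChrom-independent
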